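{- Suppose $0<2\epsilon<d<1$ and that $G$ is an $(\epsilon,d)$-super-regular bipartite graph with vertex partition $(A,B)$. Then the irregularity-graph $J_G(A,d,\epsilon)$ satisfies $\Delta(J_G(A,d,\epsilon))\leq 2\epsilon|A|$.
   Context: For $a,b,c\in\mathbb{R}$, $a=b\pm c$ means $b-c\leq a\leq b+c$. For disjoint vertex sets $U,W$ in a graph $G$, $e_G(U,W)$ is the number of edges joining $U$ and $W$ and $\mathrm{den}_G(U,W)=e_G(U,W)/(|U||W|)$. A bipartite graph $G$ with vertex partition $(A,B)$ is $(\epsilon,d)$-regular if for all $A'\subseteq A$, $B'\subseteq B$ with $|A'|\geq\epsilon|A|$, $|B'|\geq\epsilon|B|$ we have $|\mathrm{den}_G(A',B')-d|<\epsilon$. It is $(\epsilon,d)$-super-regular if it is $(\epsilon,d)$-regular and $d_G(a)=(d\pm\epsilon)|B|$ for all $a\in A$ and $d_G(b)=(d\pm\epsilon)|A|$ for all $b\in B$. For $u,v\in V(G)$, $d_G(u,v)=|N_G(u)\cap N_G(v)|$. The irregularity-graph $J_G(A,d,\epsilon)$ is the graph (possibly with loops) with vertex set $A$ and edge set $\{aa' : a,a'\in A,\ d_G(a,a')\neq (d^2\pm 3\epsilon)|B|\}$, i.e. $aa'$ (with $a=a'$ allowed, giving a loop) is an edge iff $d_G(a,a')$ is not within $3\epsilon|B|$ of $d^2|B|$. $\Delta(\cdot)$ denotes maximum degree. -}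

module Defs where

open import Data.Bool using (Bool; true; false; if_then_else_; not; _∧_)
open import Data.Nat as ℕ using (ℕ; zero; suc)
open import Data.Fin using (Fin)
open import Data.Fin.Subset as Sub using (Subset; _∩_; _∈_; _⊆_)
open import Data.Vec using (Vec; tabulate; lookup; foldr)
import Data.Vec as Vec
open import Data.Integer using (+_)
open import Data.Rational using (ℚ; _/_; 0ℚ; _+_; _-_; _*_; _≤_; _<_; ∣_∣)
open import Data.Rational.Properties using (_≤?_)
open import Relation.Nullary using (does)
open import Data.Product using (_×_)

toℚ : ℕ → ℚ
toℚ k = + k / 1

-- A bipartite graph with vertex partition (A,B), A = Fin m, B = Fin n,
-- given by its (decidable) adjacency relation between A and B.
BipGraph : ℕ → ℕ → Set
BipGraph m n = Fin m → Fin n → Bool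

module _ {m n : ℕ} (G : BipGraph m n) where

  nbhd : Fin m → Subset n
  nbhd a = tabulate (G a)

  nbhdB : Fin n → Subset m
  nbhdB b = tabulate (λ a → G a b)

  degA : Fin m → ℕ
  degA a = Sub.∣ nbhd a ∣

  degB : Fin n → ℕ
  degB b = Sub.∣ nbhdB b ∣

  eG : Subset m → Subset n → ℕ
  eG U W = Vec.sum (tabulate (λ a → if lookup U a then Sub.∣ W ∩ nbhd a ∣ else 0))

  -- den_G(U,W) = e_G(U,W)/(|U||W|)   (convention: 0 when U or W is empty)
  den : Subset m → Subset n → ℚ
  den U W with Sub.∣ U ∣ ℕ.* Sub.∣ W ∣
  ... | zero  = 0ℚ
  ... | suc k = + eG U W / suc k

  codeg : Fin m → Fin m → ℕ
  codeg a a' = Sub.∣ nbhd a ∩ nbhd a' ∣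

_≐_±_ : ℚ → ℚ → ℚ → Set
x ≐ c ± r = (c - r ≤ x) × (x ≤ c + r)

within? : ℚ → ℚ → ℚ → Bool
within? x c r = does (c - r ≤? x) ∧ does (x ≤? c + r)

IsRegular : {m n : ℕ} → BipGraph m n → ℚ → ℚ → Set
IsRegular {m} {n} G ε d =
  (A' : Subset m) (B' : Subset n) →
  ε * toℚ m ≤ toℚ Sub.∣ A' ∣ → ε * toℚ n ≤ toℚ Sub.∣ B' ∣ →
  ∣ den G A' B' - d ∣ < ε

IsSuperRegular : {m n : ℕ} → BipGraph m n → ℚ → ℚ → Set
IsSuperRegular {m} {n} G ε d =
  IsRegular G ε d
  × ((a : Fin m) → toℚ (degA G a) ≐ d * toℚ n ± (ε * toℚ n))
  × ((b : Fin n) → toℚ (degB G b) ≐ d * toℚ m ± (ε * toℚ m))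

-- Irregularity graph J_G(A,d,ε) on vertex set A (loops allowed):
-- aa' is an edge iff d_G(a,a') ≠ (d² ± 3ε)|B|.
JEdge : {m n : ℕ} → BipGraph m n → ℚ → ℚ → Fin m → Fin m → Bool
JEdge {m} {n} G d ε a a' =
  not (within? (toℚ (codeg G a a')) ((d * d) * toℚ n) ((+ 3 / 1) * ε * toℚ n))

-- degree in J = size of neighbourhood N_J(a) (a loop contributes a ∈ N_J(a))
degJ : {m n : ℕ} → BipGraph m n → ℚ → ℚ → Fin m → ℕ
degJ G d ε a = Sub.∣ tabulate (JEdge G d ε a) ∣

ΔJ : {m n : ℕ} → BipGraph m n → ℚ → ℚ → ℕ
ΔJ G d ε = foldr _ ℕ._⊔_ 0 (tabulate (degJ G d ε))

-- Fix a ∈ A and put D = deg a = (d ± ε)|B|. Since (d ± ε)² lies within 3ε of d², every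
-- J-neighbour a' of a has codegree d_G(a,a') ≥ (d + ε)D or ≤ (d - ε)D: it is heavy or light
-- towards N(a). As |N(a)| ≥ (d - ε)|B| ≥ ε|B|, a set of ε|A| heavy (light) vertices would make
-- the pair with N(a) have density ≥ d + ε (≤ d - ε), against regularity. So deg_J a < 2ε|A|.
module Submission where

open import Defs
open import Data.Bool using (Bool; true; not; _∧_)
open import Data.Fin using (Fin; zero; suc)
open import Data.Fin.Subset using (Subset; inside; outside; ∣_∣; _∩_; _∪_; _∈_; _⊆_)
open import Data.Fin.Subset.Properties using (∣p∣≤∣x∷p∣; p⊆q⇒∣p∣≤∣q∣; x∈p∪q⁺)
open import Data.Integer as ℤ using (+_)
import Data.Integer.Properties as ℤ
open import Data.Nat as ℕ using (ℕ; zero; suc; z≤n; s≤s)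
open import Data.Nat.Coprimality as Coprime using (1-coprimeTo)
import Data.Nat.Properties as ℕ
open import Data.Product using (_×_; _,_; proj₁; proj₂)
open import Data.Rational as ℚ hiding (∣_∣)
open import Data.Rational.Properties
open import Data.Rational.Solver using (module +-*-Solver)
open import Data.Rational.Unnormalised as ℚᵘ using (mkℚᵘ; *≡*)
import Data.Rational.Unnormalised.Properties as ℚᵘ
open import Data.Sum using (_⊎_; inj₁; inj₂)
open import Data.Vec using ([]; _∷_; here; there; tabulate; foldr)
open import Data.Vec.Properties using (lookup∘tabulate; lookup⇒[]=; []=⇒lookup)
open import Function using (_∘_)
open import Relation.Nullary using (Dec; yes; no; does; contradiction)
open import Relation.Nullary.Decidable using (dec-true)
open import Relation.Binary.PropositionalEquality

open +-*-Solver

-- toℚ k = + k / 1 normalises through gcd, which is stuck on variables; the operations of ℚ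
-- compute on this form instead.
toℚ≡mkℚ : ∀ k → toℚ k ≡ mkℚ (+ k) 0 (Coprime.sym (1-coprimeTo k))
toℚ≡mkℚ k = normalize-coprime (Coprime.sym (1-coprimeTo k))

toℚ-+ : ∀ a b → toℚ (a ℕ.+ b) ≡ toℚ a + toℚ b
toℚ-+ a b = begin
  + (a ℕ.+ b) / 1                    ≡⟨ cong (_/ 1) (sym (cong₂ ℤ._+_ (ℤ.*-identityʳ (+ a)) (ℤ.*-identityʳ (+ b)))) ⟩
  (+ a ℤ.* + 1 ℤ.+ + b ℤ.* + 1) / 1  ≡⟨ cong₂ _+_ (sym (toℚ≡mkℚ a)) (sym (toℚ≡mkℚ b)) ⟩
  toℚ a + toℚ b                      ∎
  where open ≡-Reasoning

toℚ-* : ∀ a b → toℚ (a ℕ.* b) ≡ toℚ a * toℚ b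
toℚ-* a b = begin
  + (a ℕ.* b) / 1    ≡⟨ cong (_/ 1) (ℤ.pos-* a b) ⟩
  (+ a ℤ.* + b) / 1  ≡⟨ cong₂ _*_ (sym (toℚ≡mkℚ a)) (sym (toℚ≡mkℚ b)) ⟩
  toℚ a * toℚ b      ∎
  where open ≡-Reasoning

toℚ-mono-≤ : ∀ {a b} → a ℕ.≤ b → toℚ a ≤ toℚ b
toℚ-mono-≤ {a} {b} a≤b rewrite toℚ≡mkℚ a | toℚ≡mkℚ b =
  *≤* (subst₂ ℤ._≤_ (sym (ℤ.*-identityʳ (+ a))) (sym (ℤ.*-identityʳ (+ b))) (ℤ.+≤+ a≤b))

toℚ-mono-< : ∀ {a b} → a ℕ.< b → toℚ a < toℚ b
toℚ-mono-< {a} {b} a<b rewrite toℚ≡mkℚ a | toℚ≡mkℚ b =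
  *<* (subst₂ ℤ._<_ (sym (ℤ.*-identityʳ (+ a))) (sym (ℤ.*-identityʳ (+ b))) (ℤ.+<+ a<b))

toℚ-nonNeg : ∀ k → 0ℚ ≤ toℚ k
toℚ-nonNeg k = toℚ-mono-≤ {0} {k} z≤n

*-toℚ-suc : ∀ c k → c * toℚ (suc k) ≡ c + c * toℚ k
*-toℚ-suc c k = begin
  c * toℚ (1 ℕ.+ k)     ≡⟨ cong (c *_) (toℚ-+ 1 k) ⟩
  c * (1ℚ + toℚ k)      ≡⟨ *-distribˡ-+ c 1ℚ (toℚ k) ⟩
  c * 1ℚ + c * toℚ k    ≡⟨ cong (_+ c * toℚ k) (*-identityʳ c) ⟩
  c + c * toℚ k         ∎
  where open ≡-Reasoning

m/n*n≡m : ∀ e k → (+ e / suc k) * toℚ (suc k) ≡ toℚ e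
m/n*n≡m e k = toℚᵘ-injective (begin
  toℚᵘ ((+ e / suc k) * toℚ (suc k))              ≈⟨ toℚᵘ-homo-* (+ e / suc k) (toℚ (suc k)) ⟩
  toℚᵘ (+ e / suc k) ℚᵘ.* toℚᵘ (toℚ (suc k))      ≈⟨ ℚᵘ.*-cong (toℚᵘ-fromℚᵘ (mkℚᵘ (+ e) k)) (toℚᵘ-fromℚᵘ (mkℚᵘ (+ suc k) 0)) ⟩
  mkℚᵘ (+ e) k ℚᵘ.* mkℚᵘ (+ suc k) 0              ≈⟨ *≡* (ℤ.*-assoc (+ e) (+ suc k) (+ 1)) ⟩
  mkℚᵘ (+ e) 0                                    ≈⟨ ℚᵘ.≃-sym (toℚᵘ-fromℚᵘ (mkℚᵘ (+ e) 0)) ⟩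
  toℚᵘ (toℚ e)                                    ∎)
  where open ℚᵘ.≃-Reasoning

p≤∣p∣ : ∀ p → p ≤ ℚ.∣ p ∣
p≤∣p∣ p with ∣p∣≡p∨∣p∣≡-p p
... | inj₁ ∣p∣≡p  = ≤-reflexive (sym ∣p∣≡p)
... | inj₂ ∣p∣≡-p = ≤-trans p≤0 (0≤∣p∣ p)
  where
  p≤0 : p ≤ 0ℚ
  p≤0 = subst (_≤ 0ℚ) (solve 1 (λ p → :- :- p := p) refl p)
              (neg-antimono-≤ (subst (0ℚ ≤_) ∣p∣≡-p (0≤∣p∣ p)))

-p≤∣p∣ : ∀ p → - p ≤ ℚ.∣ p ∣
-p≤∣p∣ p = subst (- p ≤_) (∣-p∣≡∣p∣ p) (p≤∣p∣ (- p))

∣p-q∣<r⇒q-r<p<q+r : ∀ {p q r} → ℚ.∣ p - q ∣ < r → q - r < p × p < q + r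
∣p-q∣<r⇒q-r<p<q+r {p} {q} {r} ∣p-q∣<r = q-r<p , p<q+r
  where
  open ≤-Reasoning
  q-r<p : q - r < p
  q-r<p = begin-strict
    q - r               <⟨ +-monoʳ-< q (neg-antimono-< (≤-<-trans (-p≤∣p∣ (p - q)) ∣p-q∣<r)) ⟩
    q + - - (p - q)     ≡⟨ solve 2 (λ p q → q :+ :- :- (p :- q) := p) refl p q ⟩
    p                   ∎
  p<q+r : p < q + r
  p<q+r = begin-strict
    p                   ≡⟨ solve 2 (λ p q → p := q :+ (p :- q)) refl p q ⟩
    q + (p - q)         <⟨ +-monoʳ-< q (≤-<-trans (p≤∣p∣ (p - q)) ∣p-q∣<r) ⟩
    q + r               ∎

within?-complete : ∀ {x c r} → x ≐ c ± r → within? x c r ≡ true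
within?-complete {x} {c} {r} (c-r≤x , x≤c+r) =
  cong₂ _∧_ (dec-true (c - r ≤? x) c-r≤x) (dec-true (x ≤? c + r) x≤c+r)

¬within?⇒outside : ∀ x c r → not (within? x c r) ≡ true → x < c - r ⊎ c + r < x
¬within?⇒outside x c r ¬within with c - r ≤? x | x ≤? c + r
... | no c-r≰x  | _         = inj₁ (≰⇒> c-r≰x)
... | yes _     | no x≰c+r  = inj₂ (≰⇒> x≰c+r)
... | yes c-r≤x | yes x≤c+r =
  contradiction (trans (sym ¬within) (cong not (within?-complete {x} {c} {r} (c-r≤x , x≤c+r)))) λ ()

p≤q⇒0≤q-p : ∀ {p q} → p ≤ q → 0ℚ ≤ q - p
p≤q⇒0≤q-p {p} {q} p≤q = ≤-trans (≤-reflexive (sym (+-inverseʳ p))) (+-monoˡ-≤ (- p) p≤q)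

module _ {ε d : ℚ} (0≤ε : 0ℚ ≤ ε) (ε≤d : ε ≤ d) (d≤1 : d ≤ 1ℚ) where

  private
    d+d≤2 : d + d ≤ 1ℚ + 1ℚ
    d+d≤2 = +-mono-≤ d≤1 d≤1

    ε*-mono : ∀ {p q} → p ≤ q → ε * p ≤ ε * q
    ε*-mono = *-monoˡ-≤-nonNeg ε {{nonNegative 0≤ε}}

  [d+ε]²≤d²+3ε : (d + ε) * (d + ε) ≤ d * d + (+ 3 / 1) * ε
  [d+ε]²≤d²+3ε = begin
    (d + ε) * (d + ε)         ≡⟨ solve 2 (λ d ε → (d :+ ε) :* (d :+ ε) := d :* d :+ ε :* (d :+ d :+ ε)) refl d ε ⟩
    d * d + ε * (d + d + ε)   ≤⟨ +-monoʳ-≤ (d * d) (ε*-mono (+-mono-≤ d+d≤2 (≤-trans ε≤d d≤1))) ⟩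
    d * d + ε * (+ 3 / 1)     ≡⟨ cong (λ t → d * d + t) (*-comm ε (+ 3 / 1)) ⟩
    d * d + (+ 3 / 1) * ε     ∎
    where open ≤-Reasoning

  d²-3ε≤[d-ε]² : d * d - (+ 3 / 1) * ε ≤ (d - ε) * (d - ε)
  d²-3ε≤[d-ε]² = begin
    d * d - (+ 3 / 1) * ε     ≡⟨ cong (λ t → d * d - t) (*-comm (+ 3 / 1) ε) ⟩
    d * d - ε * (+ 3 / 1)     ≤⟨ +-monoʳ-≤ (d * d) (neg-antimono-≤ (ε*-mono (+-mono-≤ d+d≤2 -ε≤1))) ⟩
    d * d - ε * (d + d - ε)   ≡⟨ solve 2 (λ d ε → d :* d :- ε :* (d :+ d :- ε) := (d :- ε) :* (d :- ε)) refl d ε ⟩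
    (d - ε) * (d - ε)         ∎
    where
    open ≤-Reasoning
    -ε≤1 : - ε ≤ 1ℚ
    -ε≤1 = ≤-trans (neg-antimono-≤ 0≤ε) (<⇒≤ (positive⁻¹ 1ℚ))

  module _ {N D : ℚ} (0≤N : 0ℚ ≤ N) where

    [d+ε]*D≤d²N+3εN : D ≤ d * N + ε * N → (d + ε) * D ≤ d * d * N + (+ 3 / 1) * ε * N
    [d+ε]*D≤d²N+3εN D≤[d+ε]N = begin
      (d + ε) * D                ≤⟨ *-monoˡ-≤-nonNeg (d + ε) {{nonNegative 0≤d+ε}} D≤ ⟩
      (d + ε) * ((d + ε) * N)    ≡⟨ sym (*-assoc (d + ε) (d + ε) N) ⟩
      (d + ε) * (d + ε) * N      ≤⟨ *-monoʳ-≤-nonNeg N {{nonNegative 0≤N}} [d+ε]²≤d²+3ε ⟩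
      (d * d + (+ 3 / 1) * ε) * N  ≡⟨ *-distribʳ-+ N (d * d) ((+ 3 / 1) * ε) ⟩
      d * d * N + (+ 3 / 1) * ε * N ∎
      where
      open ≤-Reasoning
      0≤d+ε : 0ℚ ≤ d + ε
      0≤d+ε = +-mono-≤ (≤-trans 0≤ε ε≤d) 0≤ε
      D≤ : D ≤ (d + ε) * N
      D≤ = ≤-trans D≤[d+ε]N (≤-reflexive (sym (*-distribʳ-+ N d ε)))

    d²N-3εN≤[d-ε]*D : d * N - ε * N ≤ D → d * d * N - (+ 3 / 1) * ε * N ≤ (d - ε) * D
    d²N-3εN≤[d-ε]*D [d-ε]N≤D = begin
      d * d * N - (+ 3 / 1) * ε * N ≡⟨ solve 4 (λ d ε N t → d :* d :* N :- t :* ε :* N := (d :* d :- t :* ε) :* N)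
                                                refl d ε N (+ 3 / 1) ⟩
      (d * d - (+ 3 / 1) * ε) * N  ≤⟨ *-monoʳ-≤-nonNeg N {{nonNegative 0≤N}} d²-3ε≤[d-ε]² ⟩
      (d - ε) * (d - ε) * N      ≡⟨ *-assoc (d - ε) (d - ε) N ⟩
      (d - ε) * ((d - ε) * N)    ≤⟨ *-monoˡ-≤-nonNeg (d - ε) {{nonNegative (p≤q⇒0≤q-p ε≤d)}} ≤D ⟩
      (d - ε) * D                ∎
      where
      open ≤-Reasoning
      ≤D : (d - ε) * N ≤ D
      ≤D = ≤-trans (≤-reflexive (solve 3 (λ d ε N → (d :- ε) :* N := d :* N :- ε :* N) refl d ε N)) [d-ε]N≤D

∈-tabulate⁺ : ∀ {k} {f : Fin k → Bool} {i} → f i ≡ true → i ∈ tabulate f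
∈-tabulate⁺ {f = f} {i} fi≡true = lookup⇒[]= i (tabulate f) (trans (lookup∘tabulate f i) fi≡true)

∈-tabulate⁻ : ∀ {k} {f : Fin k → Bool} {i} → i ∈ tabulate f → f i ≡ true
∈-tabulate⁻ {f = f} {i} i∈f = trans (sym (lookup∘tabulate f i)) ([]=⇒lookup i∈f)

module _ {k} {P : Fin k → Set} (P? : ∀ i → Dec (P i)) where

  ∈-tabulate-does⁺ : ∀ {i} → P i → i ∈ tabulate (does ∘ P?)
  ∈-tabulate-does⁺ {i} Pi = ∈-tabulate⁺ (dec-true (P? i) Pi)

  ∈-tabulate-does⁻ : ∀ {i} → i ∈ tabulate (does ∘ P?) → P i
  ∈-tabulate-does⁻ {i} i∈P = does≡true⇒ (P? i) (∈-tabulate⁻ {f = does ∘ P?} i∈P)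
    where
    does≡true⇒ : ∀ {A : Set} (a? : Dec A) → does a? ≡ true → A
    does≡true⇒ (yes a) _ = a

∣p∪q∣≤∣p∣+∣q∣ : ∀ {k} (p q : Subset k) → ∣ p ∪ q ∣ ℕ.≤ ∣ p ∣ ℕ.+ ∣ q ∣
∣p∪q∣≤∣p∣+∣q∣ []            []            = z≤n
∣p∪q∣≤∣p∣+∣q∣ (outside ∷ p) (outside ∷ q) = ∣p∪q∣≤∣p∣+∣q∣ p q
∣p∪q∣≤∣p∣+∣q∣ (outside ∷ p) (inside  ∷ q) =
  ℕ.≤-trans (s≤s (∣p∪q∣≤∣p∣+∣q∣ p q)) (ℕ.≤-reflexive (sym (ℕ.+-suc ∣ p ∣ ∣ q ∣)))
∣p∪q∣≤∣p∣+∣q∣ (inside  ∷ p) (t       ∷ q) =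
  s≤s (ℕ.≤-trans (∣p∪q∣≤∣p∣+∣q∣ p q) (ℕ.+-monoʳ-≤ ∣ p ∣ (∣p∣≤∣x∷p∣ t q)))

foldr-⊔-tabulate-preserves : ∀ {k} (P : ℕ → Set) (f : Fin k → ℕ) →
  P 0 → (∀ i → P (f i)) → P (foldr _ ℕ._⊔_ 0 (tabulate f))
foldr-⊔-tabulate-preserves {zero}  P f P0 Pf = P0
foldr-⊔-tabulate-preserves {suc k} P f P0 Pf
  with ℕ.⊔-sel (f zero) (foldr _ ℕ._⊔_ 0 (tabulate (f ∘ suc)))
... | inj₁ ≡head = subst P (sym ≡head) (Pf zero)
... | inj₂ ≡tail = subst P (sym ≡tail) (foldr-⊔-tabulate-preserves P (f ∘ suc) P0 (Pf ∘ suc))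

c*∣U∣≤eG : ∀ {m n} (G : BipGraph m n) (U : Subset m) (W : Subset n) c →
           (∀ {a} → a ∈ U → c ≤ toℚ ∣ W ∩ nbhd G a ∣) → c * toℚ ∣ U ∣ ≤ toℚ (eG G U W)
c*∣U∣≤eG G []            W c _     = ≤-reflexive (*-zeroʳ c)
c*∣U∣≤eG G (outside ∷ U) W c below = c*∣U∣≤eG (G ∘ suc) U W c (below ∘ there)
c*∣U∣≤eG G (inside  ∷ U) W c below = begin
  c * toℚ (suc ∣ U ∣)                               ≡⟨ *-toℚ-suc c ∣ U ∣ ⟩
  c + c * toℚ ∣ U ∣                                 ≤⟨ +-mono-≤ (below here) (c*∣U∣≤eG (G ∘ suc) U W c (below ∘ there)) ⟩
  toℚ first + toℚ rest                              ≡⟨ sym (toℚ-+ first rest) ⟩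
  toℚ (eG G (inside ∷ U) W)                         ∎
  where
  open ≤-Reasoning
  first rest : ℕ
  first = ∣ W ∩ nbhd G zero ∣
  rest  = eG (G ∘ suc) U W

eG≤c*∣U∣ : ∀ {m n} (G : BipGraph m n) (U : Subset m) (W : Subset n) c →
           (∀ {a} → a ∈ U → toℚ ∣ W ∩ nbhd G a ∣ ≤ c) → toℚ (eG G U W) ≤ c * toℚ ∣ U ∣
eG≤c*∣U∣ G []            W c _     = ≤-reflexive (sym (*-zeroʳ c))
eG≤c*∣U∣ G (outside ∷ U) W c above = eG≤c*∣U∣ (G ∘ suc) U W c (above ∘ there)
eG≤c*∣U∣ G (inside  ∷ U) W c above = begin
  toℚ (eG G (inside ∷ U) W)                         ≡⟨ toℚ-+ first rest ⟩
  toℚ first + toℚ rest                              ≤⟨ +-mono-≤ (above here) (eG≤c*∣U∣ (G ∘ suc) U W c (above ∘ there)) ⟩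
  c + c * toℚ ∣ U ∣                                 ≡⟨ sym (*-toℚ-suc c ∣ U ∣) ⟩
  c * toℚ (suc ∣ U ∣)                               ∎
  where
  open ≤-Reasoning
  first rest : ℕ
  first = ∣ W ∩ nbhd G zero ∣
  rest  = eG (G ∘ suc) U W

module _ {m n : ℕ} (G : BipGraph m n) (U : Subset m) (W : Subset n) where

  den>0⇒size>0 : 0ℚ < den G U W → 0ℚ < toℚ (∣ U ∣ ℕ.* ∣ W ∣)
  den>0⇒size>0 den>0 with ∣ U ∣ ℕ.* ∣ W ∣
  ... | zero  = den>0
  ... | suc k = toℚ-mono-< {0} {suc k} (s≤s z≤n)

  den>0⇒den*size≡eG : 0ℚ < den G U W → den G U W * toℚ (∣ U ∣ ℕ.* ∣ W ∣) ≡ toℚ (eG G U W)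
  den>0⇒den*size≡eG den>0 with ∣ U ∣ ℕ.* ∣ W ∣
  ... | zero  = contradiction den>0 (<-irrefl refl)
  ... | suc k = m/n*n≡m (eG G U W) k

  private
    c*size≡c∣W∣*∣U∣ : ∀ c → c * toℚ (∣ U ∣ ℕ.* ∣ W ∣) ≡ c * toℚ ∣ W ∣ * toℚ ∣ U ∣
    c*size≡c∣W∣*∣U∣ c = begin
      c * toℚ (∣ U ∣ ℕ.* ∣ W ∣)   ≡⟨ cong (c *_) (toℚ-* ∣ U ∣ ∣ W ∣) ⟩
      c * (toℚ ∣ U ∣ * toℚ ∣ W ∣)  ≡⟨ solve 3 (λ c u w → c :* (u :* w) := c :* w :* u) refl c (toℚ ∣ U ∣) (toℚ ∣ W ∣) ⟩
      c * toℚ ∣ W ∣ * toℚ ∣ U ∣    ∎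
      where open ≡-Reasoning

  c∣W∣≤degrees⇒c≤den : ∀ {c} → 0ℚ < den G U W →
    (∀ {a} → a ∈ U → c * toℚ ∣ W ∣ ≤ toℚ ∣ W ∩ nbhd G a ∣) → c ≤ den G U W
  c∣W∣≤degrees⇒c≤den {c} den>0 below =
    *-cancelʳ-≤-pos (toℚ (∣ U ∣ ℕ.* ∣ W ∣)) {{positive (den>0⇒size>0 den>0)}} (begin
      c * toℚ (∣ U ∣ ℕ.* ∣ W ∣)          ≡⟨ c*size≡c∣W∣*∣U∣ c ⟩
      c * toℚ ∣ W ∣ * toℚ ∣ U ∣           ≤⟨ c*∣U∣≤eG G U W (c * toℚ ∣ W ∣) below ⟩
      toℚ (eG G U W)                       ≡⟨ sym (den>0⇒den*size≡eG den>0) ⟩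
      den G U W * toℚ (∣ U ∣ ℕ.* ∣ W ∣)  ∎)
    where open ≤-Reasoning

  degrees≤c∣W∣⇒den≤c : ∀ {c} → 0ℚ < den G U W →
    (∀ {a} → a ∈ U → toℚ ∣ W ∩ nbhd G a ∣ ≤ c * toℚ ∣ W ∣) → den G U W ≤ c
  degrees≤c∣W∣⇒den≤c {c} den>0 above =
    *-cancelʳ-≤-pos (toℚ (∣ U ∣ ℕ.* ∣ W ∣)) {{positive (den>0⇒size>0 den>0)}} (begin
      den G U W * toℚ (∣ U ∣ ℕ.* ∣ W ∣)  ≡⟨ den>0⇒den*size≡eG den>0 ⟩
      toℚ (eG G U W)                       ≤⟨ eG≤c*∣U∣ G U W (c * toℚ ∣ W ∣) above ⟩
      c * toℚ ∣ W ∣ * toℚ ∣ U ∣           ≡⟨ sym (c*size≡c∣W∣*∣U∣ c) ⟩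
      c * toℚ (∣ U ∣ ℕ.* ∣ W ∣)          ∎)
    where open ≤-Reasoning

module _ {m n : ℕ} {G : BipGraph m n} {ε d : ℚ} (regular : IsRegular G ε d) (ε<d : ε < d)
         (W : Subset n) (W-large : ε * toℚ n ≤ toℚ ∣ W ∣) (U : Subset m) where

  private
    large⇒den≈d : ε * toℚ m ≤ toℚ ∣ U ∣ → d - ε < den G U W × den G U W < d + ε
    large⇒den≈d U-large = ∣p-q∣<r⇒q-r<p<q+r (regular U W U-large W-large)

    -- This is where ε < d is needed: it excludes the junk density 0 of an empty pair.
    large⇒den>0 : ε * toℚ m ≤ toℚ ∣ U ∣ → 0ℚ < den G U W
    large⇒den>0 U-large = ≤-<-trans (p≤q⇒0≤q-p (<⇒≤ ε<d)) (proj₁ (large⇒den≈d U-large))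

  uniformly-dense⇒small : (∀ {a} → a ∈ U → (d + ε) * toℚ ∣ W ∣ ≤ toℚ ∣ W ∩ nbhd G a ∣) →
                          toℚ ∣ U ∣ < ε * toℚ m
  uniformly-dense⇒small dense = ≰⇒> λ U-large →
    <-irrefl refl (<-≤-trans (proj₂ (large⇒den≈d U-large))
                             (c∣W∣≤degrees⇒c≤den G U W (large⇒den>0 U-large) dense))

  uniformly-sparse⇒small : (∀ {a} → a ∈ U → toℚ ∣ W ∩ nbhd G a ∣ ≤ (d - ε) * toℚ ∣ W ∣) →
                           toℚ ∣ U ∣ < ε * toℚ m
  uniformly-sparse⇒small sparse = ≰⇒> λ U-large →
    <-irrefl refl (<-≤-trans (proj₁ (large⇒den≈d U-large))
                             (degrees≤c∣W∣⇒den≤c G U W (large⇒den>0 U-large) sparse))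

module _ {m n : ℕ} {G : BipGraph m n} {ε d : ℚ}
         (0≤ε : 0ℚ ≤ ε) (2ε<d : (+ 2 / 1) * ε < d) (d≤1 : d ≤ 1ℚ) (regular : IsRegular G ε d)
         (a : Fin m) (deg-a : toℚ (degA G a) ≐ d * toℚ n ± (ε * toℚ n)) where

  private
    N D : ℚ
    N = toℚ n
    D = toℚ (degA G a)

    ε≤2ε : ε ≤ (+ 2 / 1) * ε
    ε≤2ε = begin
      ε                  ≡⟨ solve 1 (λ ε → ε := ε :+ con 0ℚ) refl ε ⟩
      ε + 0ℚ             ≤⟨ +-monoʳ-≤ ε 0≤ε ⟩
      ε + ε              ≡⟨ solve 1 (λ ε → ε :+ ε := con (+ 2 / 1) :* ε) refl ε ⟩
      (+ 2 / 1) * ε      ∎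
      where open ≤-Reasoning

    ε<d : ε < d
    ε<d = ≤-<-trans ε≤2ε 2ε<d

    N[a]-large : ε * N ≤ D
    N[a]-large = begin
      ε * N              ≤⟨ *-monoʳ-≤-nonNeg N {{nonNegative (toℚ-nonNeg n)}} ε≤d-ε ⟩
      (d - ε) * N        ≡⟨ solve 3 (λ d ε N → (d :- ε) :* N := d :* N :- ε :* N) refl d ε N ⟩
      d * N - ε * N      ≤⟨ proj₁ deg-a ⟩
      D                  ∎
      where
      open ≤-Reasoning
      ε≤d-ε : ε ≤ d - ε
      ε≤d-ε = begin
        ε                     ≡⟨ solve 1 (λ ε → ε := con (+ 2 / 1) :* ε :- ε) refl ε ⟩
        (+ 2 / 1) * ε - ε     ≤⟨ +-monoˡ-≤ (- ε) (<⇒≤ 2ε<d) ⟩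
        d - ε                 ∎

    heavy? : ∀ a' → Dec ((d + ε) * D ≤ toℚ (codeg G a a'))
    heavy? a' = (d + ε) * D ≤? toℚ (codeg G a a')

    light? : ∀ a' → Dec (toℚ (codeg G a a') ≤ (d - ε) * D)
    light? a' = toℚ (codeg G a a') ≤? (d - ε) * D

    heavy light : Subset m
    heavy = tabulate (does ∘ heavy?)
    light = tabulate (does ∘ light?)

    J-nbhd⊆heavy∪light : tabulate (JEdge G d ε a) ⊆ heavy ∪ light
    J-nbhd⊆heavy∪light {a'} aa'∈J
      with ¬within?⇒outside (toℚ (codeg G a a')) (d * d * N) ((+ 3 / 1) * ε * N)
                            (∈-tabulate⁻ {f = JEdge G d ε a} aa'∈J)
    ... | inj₁ below = x∈p∪q⁺ (inj₂ (∈-tabulate-does⁺ light?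
            (≤-trans (<⇒≤ below) (d²N-3εN≤[d-ε]*D 0≤ε (<⇒≤ ε<d) d≤1 (toℚ-nonNeg n) (proj₁ deg-a)))))
    ... | inj₂ above = x∈p∪q⁺ (inj₁ (∈-tabulate-does⁺ heavy?
            (≤-trans ([d+ε]*D≤d²N+3εN 0≤ε (<⇒≤ ε<d) d≤1 (toℚ-nonNeg n) (proj₂ deg-a)) (<⇒≤ above))))

    heavy-small : toℚ ∣ heavy ∣ < ε * toℚ m
    heavy-small = uniformly-dense⇒small regular ε<d (nbhd G a) N[a]-large heavy
                    (∈-tabulate-does⁻ heavy?)

    light-small : toℚ ∣ light ∣ < ε * toℚ m
    light-small = uniformly-sparse⇒small regular ε<d (nbhd G a) N[a]-large light
                    (∈-tabulate-does⁻ light?)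

  degJ≤2εm : toℚ (degJ G d ε a) ≤ (+ 2 / 1) * ε * toℚ m
  degJ≤2εm = begin
    toℚ (degJ G d ε a)                 ≤⟨ toℚ-mono-≤ (ℕ.≤-trans (p⊆q⇒∣p∣≤∣q∣ J-nbhd⊆heavy∪light)
                                                                (∣p∪q∣≤∣p∣+∣q∣ heavy light)) ⟩
    toℚ (∣ heavy ∣ ℕ.+ ∣ light ∣)      ≡⟨ toℚ-+ ∣ heavy ∣ ∣ light ∣ ⟩
    toℚ (∣ heavy ∣) + toℚ (∣ light ∣)  ≤⟨ +-mono-≤ (<⇒≤ heavy-small) (<⇒≤ light-small) ⟩
    ε * toℚ m + ε * toℚ m              ≡⟨ solve 2 (λ ε M → ε :* M :+ ε :* M := con (+ 2 / 1) :* ε :* M) refl ε (toℚ m) ⟩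
    (+ 2 / 1) * ε * toℚ m              ∎
    where open ≤-Reasoning

lemma3p8 : (m n : ℕ) (ε d : ℚ) (G : BipGraph m n) →
    0ℚ < ε → (+ 2 / 1) * ε < d → d < 1ℚ →
    IsSuperRegular G ε d →
    toℚ (ΔJ G d ε) ≤ (+ 2 / 1) * ε * toℚ m
lemma3p8 m n ε d G 0<ε 2ε<d d<1 (regular , deg-A , _) =
  foldr-⊔-tabulate-preserves (λ k → toℚ k ≤ (+ 2 / 1) * ε * toℚ m) (degJ G d ε) 0≤2εm
    (λ a → degJ≤2εm (<⇒≤ 0<ε) 2ε<d (<⇒≤ d<1) regular a (deg-A a))
  where
  0≤2εm : 0ℚ ≤ (+ 2 / 1) * ε * toℚ m
  0≤2εm = begin
    0ℚ                      ≡⟨ sym (*-zeroˡ (toℚ m)) ⟩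
    0ℚ * toℚ m              ≤⟨ *-monoʳ-≤-nonNeg (toℚ m) {{nonNegative (toℚ-nonNeg m)}} 0≤2ε ⟩
    (+ 2 / 1) * ε * toℚ m   ∎
    where
    open ≤-Reasoning
    0≤2ε : 0ℚ ≤ (+ 2 / 1) * ε
    0≤2ε = ≤-trans (≤-reflexive (sym (*-zeroʳ (+ 2 / 1)))) (*-monoˡ-≤-nonNeg (+ 2 / 1) (<⇒≤ 0<ε))
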